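{- Let $G_1$ and $G_2$ be nondeterministic automata with state sets $Q_1,Q_2$ and observable event sets $\Sigma_1,\Sigma_2$. Let $G_{i,R}$ be the reversed automaton of $G_i$ ($i=1,2$) and $G_R$ the reversed automaton of $G_1\|G_2$. Let $H_i=\Delta(det(G_i))\|\Delta_R(det(G_{i,R}))$ for $i=1,2$, and $H=\Delta(det(G_1\|G_2))\|\Delta_R(det(G_R))$. Then $H\sqsubseteq H_1\|H_2$ in the following sense: if $H\stackrel{s}{\to}(X,X_R)\stackrel{\sigma}{\to}(Y,Y_R)$ in $H$, then $H_1\|H_2\stackrel{s}{\to}((X^1,X^1_R),(X^2,X^2_R))\stackrel{\sigma}{\to}((Y^1,Y^1_R),(Y^2,Y^2_R))$ in $H_1\|H_2$ with $X_R\subseteq X^1_R\times X^2_R$ and $Y_R\subseteq Y^1_R\times Y^2_R$.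
   Context: An automaton is $G=\langle\Sigma_\tau,Q,\to,Q^\circ\rangle$ with finite set $\Sigma$ of observable events, a special unobservable event $\tau\notin\Sigma$, $\Sigma_\tau=\Sigma\cup\{\tau\}$, finite states $Q$, transitions $\to\subseteq Q\times\Sigma_\tau\times Q$ and initial states $Q^\circ$. Synchronous composition of $G_1,G_2$: states $Q_1\times Q_2$, initial states $Q_1^\circ\times Q_2^\circ$; an event in $\Sigma_1\cap\Sigma_2$ is executed jointly by both components, any other event (including $\tau$, which is never shared) is executed by the component having it while the other stays put. Reversed automaton: $G_R=\langle\Sigma_\tau,Q,\to_R,Q\rangle$ where $(x,\sigma,y)\in\to_R$ iff $y\stackrel{\sigma}{\to}x$ in $G$, and all states are initial. Current-state estimator (observer): $UR(B)$ is the set of states reachable from $B\subseteq Q$ by strings in $\{\tau\}^*$; $det(G)$ is the deterministic automaton over $\Sigma$ with initial state $UR(Q^\circ)$ and transitions $X\stackrel{\sigma}{\to}Y$, $\sigma\in\Sigma$, where $Y=\bigcup\{UR(\{y\}): x\stackrel{\sigma}{\to}y,\ x\in X\}$ is nonempty; only states reachable from the initial state are kept. Thus states of $det(G_1\|G_2)$ and $det(G_R)$ are subsets of $Q_1\times Q_2$, and states of $det(G_{i,R})$ are subsets of $Q_i$. Renamings: $\Delta(\sigma)=(\sigma,\epsilon)$ and $\Delta_R(\sigma)=(\epsilon,\sigma)$; applied to an automaton they relabel every transition accordingly. Since the renamed alphabets $\Delta(\Sigma)$ and $\Delta_R(\Sigma)$ are disjoint, $\Delta(det(G))\|\Delta_R(det(G_R))$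 (the two-way observer of $G$) has states $(X,X_R)$ and interleaves the two components; $H_1\|H_2$ synchronizes on common renamed events. -}

module Defs where

open import Level using (Level; 0ℓ; Lift; lift) renaming (suc to lsuc)
open import Data.Empty using (⊥)
open import Data.Unit using (⊤)
open import Data.Product using (Σ; ∃; _×_; _,_)
open import Data.Sum using (_⊎_)
open import Data.List using (List; []; _∷_)
open import Data.List.Membership.Propositional using (_∈_)
open import Relation.Nullary using (¬_)
open import Relation.Binary.PropositionalEquality using (_≡_)
open import Relation.Binary.Construct.Closure.ReflexiveTransitive using (Star)

-- Events: E is a global universe of event names; each automaton has its own
-- (finite) set of observable events obs ⊆ E.  τ is the unobservable event.
data Evτ (E : Set) : Set where
  τ  : Evτ E
  ev : E → Evτ E

-- Renamed events: fwd σ = (σ , ε) = Δ(σ),  bwd σ = (ε , σ) = Δ_R(σ).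
data Ren (E : Set) : Set where
  fwd : E → Ren E
  bwd : E → Ren E

record Automaton (ℓ : Level) (E : Set) : Set (lsuc ℓ) where
  field
    Q     : Set ℓ
    obs   : E → Set
    trans : Q → Evτ E → Q → Set ℓ
    init  : Q → Set ℓ
open Automaton public

WellFormed : ∀ {ℓ E} → Automaton ℓ E → Set ℓ
WellFormed G = ∀ p e q → trans G p (ev e) q → obs G e

Finite : ∀ {ℓ E} → Automaton ℓ E → Set ℓ
Finite {E = E} G =
  (Σ (List (Q G)) λ qs → ∀ q → q ∈ qs) ×
  (Σ (List E) λ es → ∀ e → obs G e → e ∈ es)

data Path {ℓ E} (G : Automaton ℓ E) : Q G → List E → Q G → Set ℓ where
  done : ∀ {q} → Path G q [] q
  step-τ : ∀ {q q' s r} → trans G q τ q' → Path G q' s r → Path G q s r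
  step-ev : ∀ {q q' e s r} → trans G q (ev e) q' → Path G q' s r → Path G q (e ∷ s) r

Reach : ∀ {ℓ E} (G : Automaton ℓ E) → List E → Q G → Set ℓ
Reach G s q = ∃ λ q₀ → init G q₀ × Path G q₀ s q

_∥_ : ∀ {ℓ E} → Automaton ℓ E → Automaton ℓ E → Automaton ℓ E
_∥_ {ℓ} G₁ G₂ = record
  { Q = Q G₁ × Q G₂
  ; obs = λ e → obs G₁ e ⊎ obs G₂ e
  ; trans = tr
  ; init = λ { (p₁ , p₂) → init G₁ p₁ × init G₂ p₂ }
  }
  where
  tr : Q G₁ × Q G₂ → Evτ _ → Q G₁ × Q G₂ → Set ℓ
  tr (p₁ , p₂) τ (q₁ , q₂) =
    (trans G₁ p₁ τ q₁ × p₂ ≡ q₂) ⊎ (p₁ ≡ q₁ × trans G₂ p₂ τ q₂)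
  tr (p₁ , p₂) (ev e) (q₁ , q₂) =
    (obs G₁ e × obs G₂ e × trans G₁ p₁ (ev e) q₁ × trans G₂ p₂ (ev e) q₂)
    ⊎ ((¬ obs G₂ e) × trans G₁ p₁ (ev e) q₁ × p₂ ≡ q₂)
    ⊎ ((¬ obs G₁ e) × p₁ ≡ q₁ × trans G₂ p₂ (ev e) q₂)

rev : ∀ {E} → Automaton 0ℓ E → Automaton 0ℓ E
rev G = record
  { Q = Q G
  ; obs = obs G
  ; trans = λ x σ y → trans G y σ x
  ; init = λ _ → ⊤
  }

UR : ∀ {E} (G : Automaton 0ℓ E) → (Q G → Set) → Q G → Set
UR G B q = ∃ λ p → B p × Star (λ x y → trans G x τ y) p q

post : ∀ {E} (G : Automaton 0ℓ E) → (Q G → Set) → E → Q G → Set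
post G X σ q = ∃ λ x → ∃ λ y → X x × trans G x (ev σ) y × Star (λ a b → trans G a τ b) y q

det : ∀ {E} → Automaton 0ℓ E → Automaton (lsuc 0ℓ) E
det G = record
  { Q = Q G → Set
  ; obs = obs G
  ; trans = tr
  ; init = λ X → X ≡ UR G (init G)
  }
  where
  tr : (Q G → Set) → Evτ _ → (Q G → Set) → Set₁
  tr X τ Y = Lift _ ⊥
  tr X (ev σ) Y = obs G σ × Y ≡ post G X σ × (∃ λ q → post G X σ q)

Δ : ∀ {ℓ E} → Automaton ℓ E → Automaton ℓ (Ren E)
Δ {ℓ} G = record
  { Q = Q G
  ; obs = λ { (fwd e) → obs G e ; (bwd e) → ⊥ }
  ; trans = λ { p τ q → trans G p τ q
              ; p (ev (fwd e)) q → trans G p (ev e) q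
              ; p (ev (bwd e)) q → Lift ℓ ⊥ }
  ; init = init G
  }

ΔR : ∀ {ℓ E} → Automaton ℓ E → Automaton ℓ (Ren E)
ΔR {ℓ} G = record
  { Q = Q G
  ; obs = λ { (fwd e) → ⊥ ; (bwd e) → obs G e }
  ; trans = λ { p τ q → trans G p τ q
              ; p (ev (fwd e)) q → Lift ℓ ⊥
              ; p (ev (bwd e)) q → trans G p (ev e) q }
  ; init = init G
  }

twoWay : ∀ {E} → Automaton 0ℓ E → Automaton (lsuc 0ℓ) (Ren E)
twoWay G = Δ (det G) ∥ ΔR (det (rev G))

module Submission where

-- A set X ⊆ Q₁ × Q₂ is *covered* by (X₁ , X₂) when X ⊆ X₁ × X₂ and both X₁
-- and X₂ are closed under τ-steps.  The proof is a simulation argument whose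
-- invariant relates a state (X , X_R) of H to a state ((X¹,X¹_R),(X²,X²_R))
-- of H₁ ∥ H₂ when X is covered by (X¹ , X²) and X_R by (X¹_R , X²_R).
--
--  * Observer simulation: if X is covered by (X₁ , X₂) and det(A ∥ B) moves
--    X --e--> Y, then det A ∥ det B moves (X₁ , X₂) --e--> (Y₁ , Y₂) with Y
--    covered by (Y₁ , Y₂); each Yᵢ is post Xᵢ e or Xᵢ according to whether
--    component i takes part in e.
--  * Reversal commutes with composition up to inclusion: every transition of
--    rev (A ∥ B) is one of rev A ∥ rev B, so the observer simulation also
--    applies to the backward observers.
--  * In a two-way observer a forward event moves only the forward component
--    and a backward event only the backward one, so steps of det ∥ det lift
--    to steps of the composed two-way observers.
--  * A step-wise simulation of a τ-free automaton extends to paths; the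
--    initial states are related, which gives the theorem.

open import Defs
open import Level using (Level; 0ℓ; lift)
open import Data.List using (List)
open import Data.Product using (∃; _×_; _,_; proj₁; proj₂)
open import Data.Sum using (inj₁; inj₂; [_,_])
open import Data.Empty using (⊥-elim)
open import Data.Unit using (tt)
open import Relation.Nullary using (¬_)
open import Relation.Binary.PropositionalEquality using (_≡_; refl; sym)
open import Relation.Binary.Construct.Closure.ReflexiveTransitive
  using (Star; ε; _◅_; _◅◅_; map; kleisliStar)

τStep : ∀ {E} (G : Automaton 0ℓ E) → Q G → Q G → Set
τStep G p q = trans G p τ q

Closed : ∀ {E} (G : Automaton 0ℓ E) → (Q G → Set) → Set
Closed G X = ∀ {p q} → X p → trans G p τ q → X q

closed-τ* : ∀ {E} (G : Automaton 0ℓ E) {X : Q G → Set} → Closed G X →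
  ∀ {p q} → X p → Star (τStep G) p q → X q
closed-τ* G closed x ε        = x
closed-τ* G closed x (t ◅ ts) = closed-τ* G closed (closed x t) ts

post-closed : ∀ {E} (G : Automaton 0ℓ E) X e → Closed G (post G X e)
post-closed G X e (x , y , x∈X , t , ts) t′ = x , y , x∈X , t , ts ◅◅ (t′ ◅ ε)

UR-closed : ∀ {E} (G : Automaton 0ℓ E) B → Closed G (UR G B)
UR-closed G B (p , p∈B , ts) t′ = p , p∈B , ts ◅◅ (t′ ◅ ε)

rev-wellFormed : ∀ {E} {G : Automaton 0ℓ E} → WellFormed G → WellFormed (rev G)
rev-wellFormed wf p e q t = wf q e p t

-- Every transition of rev (A ∥ B) is a transition of rev A ∥ rev B (the two
-- differ only in the orientation of the equation for the idle component).
module Reversal {E : Set} (A B : Automaton 0ℓ E) where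

  rev-∥ : ∀ {p σ q} → trans (rev (A ∥ B)) p σ q → trans (rev A ∥ rev B) p σ q
  rev-∥ {σ = τ}    (inj₁ (t , eq))              = inj₁ (t , sym eq)
  rev-∥ {σ = τ}    (inj₂ (eq , t))              = inj₂ (sym eq , t)
  rev-∥ {σ = ev e} (inj₁ ts)                    = inj₁ ts
  rev-∥ {σ = ev e} (inj₂ (inj₁ (n , t , eq)))   = inj₂ (inj₁ (n , t , sym eq))
  rev-∥ {σ = ev e} (inj₂ (inj₂ (n , eq , t)))   = inj₂ (inj₂ (n , sym eq , t))

  rev-∥-τ : ∀ {p q} → τStep (rev (A ∥ B)) p q → τStep (rev A ∥ rev B) p q
  rev-∥-τ = rev-∥ {σ = τ}

  post-rev-∥ : ∀ {X e q} → post (rev (A ∥ B)) X e q → post (rev A ∥ rev B) X e q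
  post-rev-∥ (x , y , x∈X , t , ts) = x , y , x∈X , rev-∥ {σ = ev _} t , map rev-∥-τ ts

  UR-rev-∥ : ∀ {S q} → UR (rev (A ∥ B)) S q → UR (rev A ∥ rev B) S q
  UR-rev-∥ (p , p∈S , ts) = p , p∈S , map rev-∥-τ ts

module ObserverSimulation {E : Set} {A B : Automaton 0ℓ E}
                          (wfA : WellFormed A) (wfB : WellFormed B) where

  record Covers (X : Q A × Q B → Set) (X₁ : Q A → Set) (X₂ : Q B → Set) : Set where
    field
      ⊆× : ∀ q₁ q₂ → X (q₁ , q₂) → X₁ q₁ × X₂ q₂
      closed₁ : Closed A X₁
      closed₂ : Closed B X₂
  open Covers public

  covers-⊆ : ∀ {X X′ X₁ X₂} → (∀ {q} → X′ q → X q) → Covers X X₁ X₂ → Covers X′ X₁ X₂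
  covers-⊆ X′⊆X c = record
    { ⊆× = λ q₁ q₂ x → ⊆× c q₁ q₂ (X′⊆X x) ; closed₁ = closed₁ c ; closed₂ = closed₂ c }

  -- A silent step of A ∥ B is a silent step of one component; so silent
  -- paths of A ∥ B project to silent paths of A and of B.
  τ*-proj₁ : ∀ {p q} → Star (τStep (A ∥ B)) p q → Star (τStep A) (proj₁ p) (proj₁ q)
  τ*-proj₁ = kleisliStar proj₁ step
    where
    step : ∀ {p q} → trans (A ∥ B) p τ q → Star (τStep A) (proj₁ p) (proj₁ q)
    step (inj₁ (t , _))      = t ◅ ε
    step (inj₂ (refl , _))   = ε

  τ*-proj₂ : ∀ {p q} → Star (τStep (A ∥ B)) p q → Star (τStep B) (proj₂ p) (proj₂ q)
  τ*-proj₂ = kleisliStar proj₂ step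
    where
    step : ∀ {p q} → trans (A ∥ B) p τ q → Star (τStep B) (proj₂ p) (proj₂ q)
    step (inj₁ (_ , refl))   = ε
    step (inj₂ (_ , t))      = t ◅ ε

  UR-covers : ∀ {S S₁ S₂} → (∀ q₁ q₂ → S (q₁ , q₂) → S₁ q₁ × S₂ q₂) →
    Covers (UR (A ∥ B) S) (UR A S₁) (UR B S₂)
  UR-covers S⊆ = record
    { ⊆× = λ { q₁ q₂ ((p₁ , p₂) , p∈S , ts) →
               (p₁ , proj₁ (S⊆ p₁ p₂ p∈S) , τ*-proj₁ ts)
             , (p₂ , proj₂ (S⊆ p₁ p₂ p∈S) , τ*-proj₂ ts) }
    ; closed₁ = UR-closed A _
    ; closed₂ = UR-closed B _ }

  data Participation (e : E) : Set where
    both  : obs A e → obs B e → Participation e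
    onlyA : obs A e → ¬ obs B e → Participation e
    onlyB : ¬ obs A e → obs B e → Participation e

  participation : ∀ {X e q} → post (A ∥ B) X e q → Participation e
  participation (_ , _ , _ , inj₁ (o₁ , o₂ , _ , _) , _)       = both o₁ o₂
  participation (_ , _ , _ , inj₂ (inj₁ (n₂ , t₁ , _)) , _)    = onlyA (wfA _ _ _ t₁) n₂
  participation (_ , _ , _ , inj₂ (inj₂ (n₁ , _ , t₂)) , _)    = onlyB n₁ (wfB _ _ _ t₂)

  module _ {X X₁ X₂} (cov : Covers X X₁ X₂) {e : E} where

    post-follows₁ : obs A e → ∀ {q} → post (A ∥ B) X e q → post A X₁ e (proj₁ q)
    post-follows₁ _ (x , _ , x∈X , inj₁ (_ , _ , t₁ , _) , ts) =
      proj₁ x , _ , proj₁ (⊆× cov _ _ x∈X) , t₁ , τ*-proj₁ ts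
    post-follows₁ _ (x , _ , x∈X , inj₂ (inj₁ (_ , t₁ , _)) , ts) =
      proj₁ x , _ , proj₁ (⊆× cov _ _ x∈X) , t₁ , τ*-proj₁ ts
    post-follows₁ o (_ , _ , _ , inj₂ (inj₂ (n₁ , _ , _)) , _) = ⊥-elim (n₁ o)

    post-follows₂ : obs B e → ∀ {q} → post (A ∥ B) X e q → post B X₂ e (proj₂ q)
    post-follows₂ _ (x , _ , x∈X , inj₁ (_ , _ , _ , t₂) , ts) =
      proj₂ x , _ , proj₂ (⊆× cov _ _ x∈X) , t₂ , τ*-proj₂ ts
    post-follows₂ o (_ , _ , _ , inj₂ (inj₁ (n₂ , _ , _)) , _) = ⊥-elim (n₂ o)
    post-follows₂ _ (x , _ , x∈X , inj₂ (inj₂ (_ , _ , t₂)) , ts) =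
      proj₂ x , _ , proj₂ (⊆× cov _ _ x∈X) , t₂ , τ*-proj₂ ts

    post-stays₁ : ¬ obs A e → ∀ {q} → post (A ∥ B) X e q → X₁ (proj₁ q)
    post-stays₁ n (_ , _ , _ , inj₁ (o₁ , _ , _ , _) , _)    = ⊥-elim (n o₁)
    post-stays₁ n (_ , _ , _ , inj₂ (inj₁ (_ , t₁ , _)) , _) = ⊥-elim (n (wfA _ _ _ t₁))
    post-stays₁ n (_ , _ , x∈X , inj₂ (inj₂ (_ , refl , _)) , ts) =
      closed-τ* A (closed₁ cov) (proj₁ (⊆× cov _ _ x∈X)) (τ*-proj₁ ts)

    post-stays₂ : ¬ obs B e → ∀ {q} → post (A ∥ B) X e q → X₂ (proj₂ q)
    post-stays₂ n (_ , _ , _ , inj₁ (_ , o₂ , _ , _) , _)    = ⊥-elim (n o₂)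
    post-stays₂ n (_ , _ , x∈X , inj₂ (inj₁ (_ , _ , refl)) , ts) =
      closed-τ* B (closed₂ cov) (proj₂ (⊆× cov _ _ x∈X)) (τ*-proj₂ ts)
    post-stays₂ n (_ , _ , _ , inj₂ (inj₂ (_ , _ , t₂)) , _) = ⊥-elim (n (wfB _ _ _ t₂))

    detStep₁ : obs A e → ∃ (post (A ∥ B) X e) → trans (det A) X₁ (ev e) (post A X₁ e)
    detStep₁ o (q , q∈Y) = o , refl , proj₁ q , post-follows₁ o q∈Y

    detStep₂ : obs B e → ∃ (post (A ∥ B) X e) → trans (det B) X₂ (ev e) (post B X₂ e)
    detStep₂ o (q , q∈Y) = o , refl , proj₂ q , post-follows₂ o q∈Y

    observer-step : ∃ (post (A ∥ B) X e) →
      ∃ λ Y₁ → ∃ λ Y₂ → trans (det A ∥ det B) (X₁ , X₂) (ev e) (Y₁ , Y₂) ×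
                        Covers (post (A ∥ B) X e) Y₁ Y₂
    observer-step ne with participation (proj₂ ne)
    ... | both o₁ o₂ = _ , _ , inj₁ (o₁ , o₂ , detStep₁ o₁ ne , detStep₂ o₂ ne) , record
      { ⊆× = λ _ _ q∈Y → post-follows₁ o₁ q∈Y , post-follows₂ o₂ q∈Y
      ; closed₁ = post-closed A X₁ e ; closed₂ = post-closed B X₂ e }
    ... | onlyA o₁ n₂ = _ , _ , inj₂ (inj₁ (n₂ , detStep₁ o₁ ne , refl)) , record
      { ⊆× = λ _ _ q∈Y → post-follows₁ o₁ q∈Y , post-stays₂ n₂ q∈Y
      ; closed₁ = post-closed A X₁ e ; closed₂ = closed₂ cov }
    ... | onlyB n₁ o₂ = _ , _ , inj₂ (inj₂ (n₁ , refl , detStep₂ o₂ ne)) , record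
      { ⊆× = λ _ _ q∈Y → post-stays₁ n₁ q∈Y , post-follows₂ o₂ q∈Y
      ; closed₁ = closed₁ cov ; closed₂ = post-closed B X₂ e }

module TwoWaySteps {ℓ : Level} {E : Set} where

  fwd-step : ∀ {D D′ : Automaton ℓ E} {x y x′ e} → trans D x (ev e) y →
    trans (Δ D ∥ ΔR D′) (x , x′) (ev (fwd e)) (y , x′)
  fwd-step t = inj₂ (inj₁ ((λ ()) , t , refl))

  bwd-step : ∀ {D D′ : Automaton ℓ E} {x x′ y′ e} → trans D′ x′ (ev e) y′ →
    trans (Δ D ∥ ΔR D′) (x , x′) (ev (bwd e)) (x , y′)
  bwd-step t = inj₂ (inj₂ ((λ ()) , refl , t))

  fwd-inv : ∀ {D D′ : Automaton ℓ E} {x y x′ y′ e} →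
    trans (Δ D ∥ ΔR D′) (x , x′) (ev (fwd e)) (y , y′) → trans D x (ev e) y × x′ ≡ y′
  fwd-inv (inj₂ (inj₁ (_ , t , eq)))        = t , eq
  fwd-inv (inj₂ (inj₂ (_ , _ , lift ())))

  bwd-inv : ∀ {D D′ : Automaton ℓ E} {x y x′ y′ e} →
    trans (Δ D ∥ ΔR D′) (x , x′) (ev (bwd e)) (y , y′) → x ≡ y × trans D′ x′ (ev e) y′
  bwd-inv (inj₂ (inj₁ (_ , lift () , _)))
  bwd-inv (inj₂ (inj₂ (_ , eq , t)))        = eq , t

  module _ {D₁ D₁′ D₂ D₂′ : Automaton ℓ E} where

    lift-fwd : ∀ {x₁ x₂ y₁ y₂ x₁′ x₂′ e} → trans (D₁ ∥ D₂) (x₁ , x₂) (ev e) (y₁ , y₂) →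
      trans ((Δ D₁ ∥ ΔR D₁′) ∥ (Δ D₂ ∥ ΔR D₂′))
        ((x₁ , x₁′) , (x₂ , x₂′)) (ev (fwd e)) ((y₁ , x₁′) , (y₂ , x₂′))
    lift-fwd (inj₁ (o₁ , o₂ , t₁ , t₂)) = inj₁ (inj₁ o₁ , inj₁ o₂ , fwd-step {D = D₁} {D′ = D₁′} t₁ , fwd-step {D = D₂} {D′ = D₂′} t₂)
    lift-fwd (inj₂ (inj₁ (n₂ , t₁ , refl))) = inj₂ (inj₁ ([ n₂ , (λ ()) ] , fwd-step {D = D₁} {D′ = D₁′} t₁ , refl))
    lift-fwd (inj₂ (inj₂ (n₁ , refl , t₂))) = inj₂ (inj₂ ([ n₁ , (λ ()) ] , refl , fwd-step {D = D₂} {D′ = D₂′} t₂))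

    lift-bwd : ∀ {x₁ x₂ x₁′ x₂′ y₁′ y₂′ e} → trans (D₁′ ∥ D₂′) (x₁′ , x₂′) (ev e) (y₁′ , y₂′) →
      trans ((Δ D₁ ∥ ΔR D₁′) ∥ (Δ D₂ ∥ ΔR D₂′))
        ((x₁ , x₁′) , (x₂ , x₂′)) (ev (bwd e)) ((x₁ , y₁′) , (x₂ , y₂′))
    lift-bwd (inj₁ (o₁ , o₂ , t₁ , t₂)) = inj₁ (inj₂ o₁ , inj₂ o₂ , bwd-step {D = D₁} {D′ = D₁′} t₁ , bwd-step {D = D₂} {D′ = D₂′} t₂)
    lift-bwd (inj₂ (inj₁ (n₂ , t₁ , refl))) = inj₂ (inj₁ ([ (λ ()) , n₂ ] , bwd-step {D = D₁} {D′ = D₁′} t₁ , refl))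
    lift-bwd (inj₂ (inj₂ (n₁ , refl , t₂))) = inj₂ (inj₂ ([ (λ ()) , n₁ ] , refl , bwd-step {D = D₂} {D′ = D₂′} t₂))

twoWay-τ-free : ∀ {E} (G : Automaton 0ℓ E) {a b} → ¬ trans (twoWay G) a τ b
twoWay-τ-free G (inj₁ (lift () , _))
twoWay-τ-free G (inj₂ (_ , lift ()))

simulate-path : ∀ {ℓ₁ ℓ₂ r E} {H : Automaton ℓ₁ E} {K : Automaton ℓ₂ E}
  (R : Q H → Q K → Set r) →
  (∀ {a b} → ¬ trans H a τ b) →
  (∀ {a b a′} σ → R a a′ → trans H a (ev σ) b → ∃ λ b′ → trans K a′ (ev σ) b′ × R b b′) →
  ∀ {a s b} → Path H a s b → ∀ {a′} → R a a′ → ∃ λ b′ → Path K a′ s b′ × R b b′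
simulate-path R τ-free sim done r = _ , done , r
simulate-path R τ-free sim (step-τ t _) r = ⊥-elim (τ-free t)
simulate-path R τ-free sim (step-ev {e = σ} t p) r with sim σ r t
... | b′ , t′ , r′ with simulate-path R τ-free sim p r′
...   | c′ , p′ , r″ = c′ , step-ev t′ p′ , r″

module TwoWaySimulation {E : Set} (G₁ G₂ : Automaton 0ℓ E)
                        (wf₁ : WellFormed G₁) (wf₂ : WellFormed G₂) where

  open Reversal G₁ G₂
  open TwoWaySteps
  module F = ObserverSimulation {A = G₁} {B = G₂} wf₁ wf₂
  module R = ObserverSimulation {A = rev G₁} {B = rev G₂}
                 (rev-wellFormed {G = G₁} wf₁) (rev-wellFormed {G = G₂} wf₂)

  G : Automaton 0ℓ E
  G = G₁ ∥ G₂

  record Related (a : Q (twoWay G)) (b : Q (twoWay G₁ ∥ twoWay G₂)) : Set where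
    field
      forward  : F.Covers (proj₁ a) (proj₁ (proj₁ b)) (proj₁ (proj₂ b))
      backward : R.Covers (proj₂ a) (proj₂ (proj₁ b)) (proj₂ (proj₂ b))
  open Related public

  -- The backward estimate of rev G starts from all states; it is covered
  -- because rev G₁ ∥ rev G₂ has at least the silent steps of rev G.
  initial-related :
    Related (UR G (init G) , UR (rev G) (init (rev G)))
            ((UR G₁ (init G₁) , UR (rev G₁) (init (rev G₁))) ,
             (UR G₂ (init G₂) , UR (rev G₂) (init (rev G₂))))
  initial-related = record
    { forward  = F.UR-covers (λ _ _ q∈S → q∈S)
    ; backward = R.covers-⊆ UR-rev-∥ (R.UR-covers (λ _ _ _ → tt , tt)) }

  -- A forward step uses the forward observer simulation; a backward step the
  -- backward one, after moving the successor set from rev G to rev G₁ ∥ rev G₂.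
  step-related : ∀ {a b a′} σ → Related a a′ → trans (twoWay G) a (ev σ) b →
    ∃ λ b′ → trans (twoWay G₁ ∥ twoWay G₂) a′ (ev σ) b′ × Related b b′
  step-related (fwd e) rel t with fwd-inv {D = det G} {D′ = det (rev G)} t
  ... | (_ , refl , ne) , refl with F.observer-step (forward rel) ne
  ...   | _ , _ , t′ , cov =
    _ , lift-fwd {D₁ = det G₁} {det (rev G₁)} {det G₂} {det (rev G₂)} t′ ,
    record { forward = cov ; backward = backward rel }
  step-related (bwd e) rel t with bwd-inv {D = det G} {D′ = det (rev G)} t
  ... | refl , (_ , refl , (q , q∈Y)) with R.observer-step (backward rel) (q , post-rev-∥ q∈Y)
  ...   | _ , _ , t′ , cov =
    _ , lift-bwd {D₁ = det G₁} {det (rev G₁)} {det G₂} {det (rev G₂)} t′ ,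
    record { forward = forward rel ; backward = R.covers-⊆ post-rev-∥ cov }

  reachable-related : ∀ {s a} → Reach (twoWay G) s a →
    ∃ λ a′ → Reach (twoWay G₁ ∥ twoWay G₂) s a′ × Related a a′
  reachable-related (_ , (refl , refl) , path)
    with simulate-path Related (twoWay-τ-free G) step-related path initial-related
  ... | a′ , path′ , rel = a′ , (_ , ((refl , refl) , (refl , refl)) , path′) , rel

proposition5 : {E : Set} (G₁ G₂ : Automaton 0ℓ E) →
    Finite G₁ → Finite G₂ → WellFormed G₁ → WellFormed G₂ →
    ∀ (s : List (Ren E)) (σ : Ren E) X XR Y YR →
    Reach (twoWay (G₁ ∥ G₂)) s (X , XR) →
    trans (twoWay (G₁ ∥ G₂)) (X , XR) (ev σ) (Y , YR) →
    ∃ λ X¹ → ∃ λ X¹R → ∃ λ X² → ∃ λ X²R →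
    ∃ λ Y¹ → ∃ λ Y¹R → ∃ λ Y² → ∃ λ Y²R →
      Reach (twoWay G₁ ∥ twoWay G₂) s ((X¹ , X¹R) , (X² , X²R)) ×
      trans (twoWay G₁ ∥ twoWay G₂) ((X¹ , X¹R) , (X² , X²R)) (ev σ)
        ((Y¹ , Y¹R) , (Y² , Y²R)) ×
      (∀ q₁ q₂ → XR (q₁ , q₂) → X¹R q₁ × X²R q₂) ×
      (∀ q₁ q₂ → YR (q₁ , q₂) → Y¹R q₁ × Y²R q₂)
proposition5 G₁ G₂ _ _ wf₁ wf₂ s σ X XR Y YR reach t
  with TwoWaySimulation.reachable-related G₁ G₂ wf₁ wf₂ reach
... | ((X¹ , X¹R) , (X² , X²R)) , reach′ , rel
  with TwoWaySimulation.step-related G₁ G₂ wf₁ wf₂ σ rel t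
... | ((Y¹ , Y¹R) , (Y² , Y²R)) , t′ , rel′ =
  X¹ , X¹R , X² , X²R , Y¹ , Y¹R , Y² , Y²R , reach′ , t′ ,
  R.⊆× (backward rel) , R.⊆× (backward rel′)
  where open TwoWaySimulation G₁ G₂ wf₁ wf₂
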